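{- Let $G$ be an unweighted multigraph with minimum degree $\delta$ and let $k\ge2$. Suppose there exists a nontrivial minimum $k$-cut in $G$. Then the size of the minimum $k$-cut satisfies $|OPT|\le k^2\delta$.
   Context: A $k$-cut of $G=(V,E)$ is a partition $S_1,\ldots,S_k$ of $V$ into $k$ nonempty parts; its size is the number of edges with endpoints in different parts. $OPT$ denotes the edge set of a minimum $k$-cut. A minimum $k$-cut $S^*_1,\ldots,S^*_k$ is nontrivial if none of the parts has size exactly $1$. The degree of a vertex is the number of edges incident to it. -}

module Defs where

open import Data.Nat using (ℕ; _≤_)
open import Data.Fin using (Fin)
open import Data.Fin.Properties using () renaming (_≟_ to _≟ᶠ_)
open import Data.List using (List; length; filter; allFin)
open import Data.Product using (_×_; _,_; proj₁; proj₂; ∃)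
open import Data.Sum using (_⊎_)
open import Relation.Binary.PropositionalEquality using (_≡_; _≢_)
open import Relation.Nullary using (¬_)
open import Relation.Nullary.Decidable using (¬?; _⊎-dec_)
open import Data.List.Relation.Unary.All using (All)

-- A finite (unweighted) multigraph on vertex set Fin n: a list of edges,
-- each edge an (unordered, stored as ordered) pair of endpoints.
-- Parallel edges are allowed (repetitions in the list).
record Multigraph (n : ℕ) : Set where
  field
    edges    : List (Fin n × Fin n)
    loopless : All (λ e → proj₁ e ≢ proj₂ e) edges
open Multigraph public

degree : ∀ {n} → Multigraph n → Fin n → ℕ
degree G v = length (filter (λ e → (proj₁ e ≟ᶠ v) ⊎-dec (proj₂ e ≟ᶠ v)) (edges G))

IsMinDegree : ∀ {n} → Multigraph n → ℕ → Set
IsMinDegree G δ = (∀ v → δ ≤ degree G v) × ∃ (λ v → degree G v ≡ δ)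

IsKCut : ∀ {n} (k : ℕ) → (Fin n → Fin k) → Set
IsKCut k p = ∀ i → ∃ (λ v → p v ≡ i)

cutSize : ∀ {n k} → Multigraph n → (Fin n → Fin k) → ℕ
cutSize G p = length (filter (λ e → ¬? (p (proj₁ e) ≟ᶠ p (proj₂ e))) (edges G))

IsMinKCut : ∀ {n} → Multigraph n → (k : ℕ) → (Fin n → Fin k) → Set
IsMinKCut G k p = IsKCut k p × (∀ q → IsKCut k q → cutSize G p ≤ cutSize G q)

partSize : ∀ {n k} → (Fin n → Fin k) → Fin k → ℕ
partSize {n} p i = length (filter (λ v → p v ≟ᶠ i) (allFin n))

Nontrivial : ∀ {n k} → (Fin n → Fin k) → Set
Nontrivial {k = k} p = ∀ (i : Fin k) → partSize p i ≢ 1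

-- For any two parts a, b of a minimum k-cut p, at most δ edges run from part a
-- to part b.  Otherwise take a vertex v of degree δ, merge part b into part a
-- and move v alone into the freed part b: by nontriviality every part stays
-- nonempty, the a–b edges not at v stop being cut, and only edges at v can
-- start being cut, so the new k-cut would be smaller.  Summing over the k²
-- ordered pairs of parts gives |OPT| ≤ k² δ.
module Submission where

open import Defs
open import Level using (Level)
open import Data.Nat using (ℕ; _≤_; _*_; _+_; zero; suc; z≤n; s≤s)
open import Data.Nat.Properties
  using (≤-refl; m≤m+n; +-mono-≤; +-monoˡ-≤; +-cancelˡ-≤; *-assoc; +-0-commutativeMonoid;
         +-commutativeSemigroup; module ≤-Reasoning)
open import Algebra.Properties.CommutativeSemigroup +-commutativeSemigroup using (interchange)
open import Algebra.Properties.CommutativeMonoid.Sum +-0-commutativeMonoid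
  using (sum-syntax; sum-cong-≗; sum-replicate-zero; ∑-distrib-+)
open import Data.Bool using (if_then_else_)
open import Data.Fin using (Fin; zero; suc)
open import Data.Fin.Properties using (any?; _≟_)
open import Data.List using (List; []; _∷_; length; filter; allFin; tabulate)
open import Data.List.Properties using (filter-≐)
open import Data.Product using (_×_; _,_; proj₁; proj₂; ∃)
open import Data.Sum using (_⊎_; inj₁; inj₂)
open import Data.Vec.Functional using (updateAt)
open import Data.Vec.Functional.Properties using (updateAt-updates; updateAt-minimal)
open import Function using (_∘_; const; id)
open import Relation.Nullary using (¬_; Dec; does; yes; no; contradiction)
open import Relation.Nullary.Decidable using (¬?; _×-dec_; _⊎-dec_)
open import Relation.Unary using (Pred; Decidable)
open import Relation.Binary.PropositionalEquality

private
  variable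
    ℓ ℓ′ : Level
    A : Set ℓ′
    m : ℕ

𝟙 : {P : Set ℓ} → Dec P → ℕ
𝟙 P? = if does P? then 1 else 0

𝟙+𝟙≤𝟙+𝟙 : {Q F P I : Set ℓ} (Q? : Dec Q) (F? : Dec F) (P? : Dec P) (I? : Dec I) →
  (F → P) → (¬ I → F → ¬ Q) → (¬ I → ¬ P → ¬ Q) → 𝟙 Q? + 𝟙 F? ≤ 𝟙 P? + 𝟙 I?
𝟙+𝟙≤𝟙+𝟙 (no _)  (no _)  _       _       _   _       _       = z≤n
𝟙+𝟙≤𝟙+𝟙 (yes _) (no _)  (yes _) _       _   _       _       = s≤s z≤n
𝟙+𝟙≤𝟙+𝟙 (yes _) (no _)  (no _)  (yes _) _   _       _       = s≤s z≤n
𝟙+𝟙≤𝟙+𝟙 (yes q) (no _)  (no ¬p) (no ¬i) _   _       ¬I¬P⇒¬Q = contradiction q (¬I¬P⇒¬Q ¬i ¬p)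
𝟙+𝟙≤𝟙+𝟙 _       (yes f) (no ¬p) _       F⇒P _       _       = contradiction (F⇒P f) ¬p
𝟙+𝟙≤𝟙+𝟙 (no _)  (yes _) (yes _) _       _   _       _       = m≤m+n 1 _
𝟙+𝟙≤𝟙+𝟙 (yes _) (yes _) (yes _) (yes _) _   _       _       = ≤-refl
𝟙+𝟙≤𝟙+𝟙 (yes q) (yes f) (yes _) (no ¬i) _   ¬IF⇒¬Q  _       = contradiction q (¬IF⇒¬Q ¬i f)

count : {P : Pred A ℓ} → Decidable P → List A → ℕ
count P? xs = length (filter P? xs)

module _ {P : Pred A ℓ} (P? : Decidable P) where

  count-∷ : ∀ x xs → count P? (x ∷ xs) ≡ 𝟙 (P? x) + count P? xs
  count-∷ x xs with P? x
  ... | yes _ = refl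
  ... | no _  = refl

  count-tabulate : (f : Fin m → A) → count P? (tabulate f) ≡ ∑[ i < m ] 𝟙 (P? (f i))
  count-tabulate {zero}  f = refl
  count-tabulate {suc m} f = trans (count-∷ (f zero) _) (cong (𝟙 (P? (f zero)) +_) (count-tabulate (f ∘ suc)))

count-+-mono : {P Q R S : Pred A ℓ} (P? : Decidable P) (Q? : Decidable Q) (R? : Decidable R) (S? : Decidable S) →
  (∀ x → 𝟙 (P? x) + 𝟙 (Q? x) ≤ 𝟙 (R? x) + 𝟙 (S? x)) →
  ∀ xs → count P? xs + count Q? xs ≤ count R? xs + count S? xs
count-+-mono P? Q? R? S? pointwise []       = z≤n
count-+-mono P? Q? R? S? pointwise (x ∷ xs) = begin
  count P? (x ∷ xs) + count Q? (x ∷ xs)                 ≡⟨ cong₂ _+_ (count-∷ P? x xs) (count-∷ Q? x xs) ⟩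
  (𝟙 (P? x) + count P? xs) + (𝟙 (Q? x) + count Q? xs)   ≡⟨ interchange (𝟙 (P? x)) _ _ _ ⟩
  (𝟙 (P? x) + 𝟙 (Q? x)) + (count P? xs + count Q? xs)   ≤⟨ +-mono-≤ (pointwise x) (count-+-mono P? Q? R? S? pointwise xs) ⟩
  (𝟙 (R? x) + 𝟙 (S? x)) + (count R? xs + count S? xs)   ≡⟨ interchange (𝟙 (R? x)) _ _ _ ⟩
  (𝟙 (R? x) + count R? xs) + (𝟙 (S? x) + count S? xs)   ≡⟨ sym (cong₂ _+_ (count-∷ R? x xs) (count-∷ S? x xs)) ⟩
  count R? (x ∷ xs) + count S? (x ∷ xs)                 ∎
  where open ≤-Reasoning

∑-𝟙-≟ : (j : Fin m) → ∑[ i < m ] 𝟙 (j ≟ i) ≡ 1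
∑-𝟙-≟ {suc m} zero    = cong suc (sum-replicate-zero m)
∑-𝟙-≟ {suc m} (suc j) = ∑-𝟙-≟ j

∑-𝟙-×-≟ : {P : Set ℓ} (P? : Dec P) (j : Fin m) → ∑[ i < m ] 𝟙 (P? ×-dec j ≟ i) ≡ 𝟙 P?
∑-𝟙-×-≟ {m = m} (no _) j = sum-replicate-zero m
∑-𝟙-×-≟         (yes _) j = ∑-𝟙-≟ j

∑-≤-* : (f : Fin m → ℕ) {c : ℕ} → (∀ i → f i ≤ c) → ∑[ i < m ] f i ≤ m * c
∑-≤-* {zero}  f f≤c = z≤n
∑-≤-* {suc m} f f≤c = +-mono-≤ (f≤c zero) (∑-≤-* (f ∘ suc) (f≤c ∘ suc))

module _ {P : Pred A ℓ} (P? : Decidable P) (f : A → Fin m) where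

  count-fibres : ∀ xs → count P? xs ≡ ∑[ i < m ] count (λ x → P? x ×-dec f x ≟ i) xs
  count-fibres []       = sym (sum-replicate-zero m)
  count-fibres (x ∷ xs) = begin
    count P? (x ∷ xs)
      ≡⟨ count-∷ P? x xs ⟩
    𝟙 (P? x) + count P? xs
      ≡⟨ cong₂ _+_ (sym (∑-𝟙-×-≟ (P? x) (f x))) (count-fibres xs) ⟩
    ∑[ i < m ] 𝟙 (Fibre i x) + ∑[ i < m ] count (Fibre i) xs
      ≡⟨ sym (∑-distrib-+ (λ i → 𝟙 (Fibre i x)) (λ i → count (Fibre i) xs)) ⟩
    ∑[ i < m ] (𝟙 (Fibre i x) + count (Fibre i) xs)
      ≡⟨ sum-cong-≗ (λ i → sym (count-∷ (Fibre i) x xs)) ⟩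
    ∑[ i < m ] count (Fibre i) (x ∷ xs)
      ∎
    where
    open ≡-Reasoning
    Fibre : (i : Fin m) → Decidable (λ x → P x × f x ≡ i)
    Fibre i x = P? x ×-dec f x ≟ i

  count-≤-fibres : ∀ xs {c} → (∀ i → count (λ x → P? x ×-dec f x ≟ i) xs ≤ c) → count P? xs ≤ m * c
  count-≤-fibres xs bound = subst (_≤ _) (sym (count-fibres xs)) (∑-≤-* _ bound)

count-≟-allFin : (v : Fin m) → count (v ≟_) (allFin m) ≡ 1
count-≟-allFin v = trans (count-tabulate (v ≟_) id) (∑-𝟙-≟ v)

module _ {n : ℕ} where

  Incident : Fin n → Pred (Fin n × Fin n) _
  Incident v e = proj₁ e ≡ v ⊎ proj₂ e ≡ v

  incident? : (v : Fin n) → Decidable (Incident v)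
  incident? v e = (proj₁ e ≟ v) ⊎-dec (proj₂ e ≟ v)

module _ {n k : ℕ} where

  Separates : (Fin n → Fin k) → Pred (Fin n × Fin n) _
  Separates r e = r (proj₁ e) ≢ r (proj₂ e)

  separates? : (r : Fin n → Fin k) → Decidable (Separates r)
  separates? r e = ¬? (r (proj₁ e) ≟ r (proj₂ e))

  -- The redundant Separates conjunct is the shape left by two rounds of count-≤-fibres.
  Crossing : (Fin n → Fin k) → Fin k → Fin k → Pred (Fin n × Fin n) _
  Crossing r a b e = (Separates r e × r (proj₁ e) ≡ a) × r (proj₂ e) ≡ b

  crossing? : (r : Fin n → Fin k) (a b : Fin k) → Decidable (Crossing r a b)
  crossing? r a b e = (separates? r e ×-dec r (proj₁ e) ≟ a) ×-dec r (proj₂ e) ≟ b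

  ∃-other-member : {p : Fin n → Fin k} → IsKCut k p → Nontrivial p → ∀ v i → ∃ λ w → w ≢ v × p w ≡ i
  ∃-other-member {p} isKCut nontrivial v i with any? (λ w → ¬? (w ≟ v) ×-dec p w ≟ i)
  ... | yes found = found
  ... | no none   = contradiction partSize≡1 (nontrivial i)
    where
    only-v : ∀ {w} → p w ≡ i → v ≡ w
    only-v {w} pw≡i with w ≟ v
    ... | yes w≡v = sym w≡v
    ... | no w≢v  = contradiction (w , w≢v , pw≡i) none

    v-member : p v ≡ i
    v-member = let (w , pw≡i) = isKCut i in subst (λ u → p u ≡ i) (sym (only-v pw≡i)) pw≡i

    partSize≡1 : partSize p i ≡ 1
    partSize≡1 = trans (cong length (filter-≐ (λ w → p w ≟ i) (v ≟_) (only-v , λ { refl → v-member }) (allFin n)))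
                       (count-≟-allFin v)

merge : ∀ {k} → Fin k → Fin k → Fin k → Fin k
merge a b c with c ≟ b
... | yes _ = a
... | no _  = c

module _ {k} (a b : Fin k) where

  merge-source : merge a b b ≡ a
  merge-source with b ≟ b
  ... | yes _   = refl
  ... | no b≢b  = contradiction refl b≢b

  merge-target : merge a b a ≡ a
  merge-target with a ≟ b
  ... | yes _ = refl
  ... | no _  = refl

  merge-other : ∀ {c} → c ≢ b → merge a b c ≡ c
  merge-other {c} c≢b with c ≟ b
  ... | yes c≡b = contradiction c≡b c≢b
  ... | no _    = refl

module _ {n k : ℕ} (p : Fin n → Fin k) (v : Fin n) (a b : Fin k) where

  mergeAndIsolate : Fin n → Fin k
  mergeAndIsolate = updateAt (merge a b ∘ p) v (const b)

  mergeAndIsolate-isKCut : IsKCut k p → Nontrivial p → IsKCut k mergeAndIsolate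
  mergeAndIsolate-isKCut isKCut nontrivial i with i ≟ b
  ... | yes refl = v , updateAt-updates v (merge a b ∘ p)
  ... | no i≢b   = let (w , w≢v , pw≡i) = ∃-other-member isKCut nontrivial v i in
    w , (begin
      mergeAndIsolate w ≡⟨ updateAt-minimal w v (merge a b ∘ p) w≢v ⟩
      merge a b (p w)   ≡⟨ cong (merge a b) pw≡i ⟩
      merge a b i       ≡⟨ merge-other a b i≢b ⟩
      i                 ∎)
    where open ≡-Reasoning

  mergeAndIsolate-edge : ∀ e → 𝟙 (separates? mergeAndIsolate e) + 𝟙 (crossing? p a b e)
                               ≤ 𝟙 (separates? p e) + 𝟙 (incident? v e)
  mergeAndIsolate-edge e@(x , y) =
    𝟙+𝟙≤𝟙+𝟙 (separates? mergeAndIsolate e) (crossing? p a b e) (separates? p e) (incident? v e)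
            (proj₁ ∘ proj₁) crossing-joined unseparated-stays
    where
    away-from-v : ¬ Incident v e → merge a b (p x) ≡ merge a b (p y) → ¬ Separates mergeAndIsolate e
    away-from-v ¬incident merged separated = separated (begin
      mergeAndIsolate x ≡⟨ updateAt-minimal x v (merge a b ∘ p) (¬incident ∘ inj₁) ⟩
      merge a b (p x)   ≡⟨ merged ⟩
      merge a b (p y)   ≡⟨ updateAt-minimal y v (merge a b ∘ p) (¬incident ∘ inj₂) ⟨
      mergeAndIsolate y ∎)
      where open ≡-Reasoning

    crossing-joined : ¬ Incident v e → Crossing p a b e → ¬ Separates mergeAndIsolate e
    crossing-joined ¬incident ((_ , px≡a) , py≡b) = away-from-v ¬incident (begin
      merge a b (p x) ≡⟨ cong (merge a b) px≡a ⟩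
      merge a b a     ≡⟨ merge-target a b ⟩
      a               ≡⟨ merge-source a b ⟨
      merge a b b     ≡⟨ cong (merge a b) py≡b ⟨
      merge a b (p y) ∎)
      where open ≡-Reasoning

    unseparated-stays : ¬ Incident v e → ¬ Separates p e → ¬ Separates mergeAndIsolate e
    unseparated-stays ¬incident ¬separated separated′ =
      ¬separated λ px≡py → away-from-v ¬incident (cong (merge a b) px≡py) separated′

crossing-count≤degree : ∀ {n k} (G : Multigraph n) {p : Fin n → Fin k} → IsMinKCut G k p → Nontrivial p →
  ∀ v a b → count (crossing? p a b) (edges G) ≤ degree G v
crossing-count≤degree {n} {k} G {p} (isKCut , minimal) nontrivial v a b =
  +-cancelˡ-≤ (cutSize G p) _ _ (begin
    cutSize G p + count (crossing? p a b) (edges G)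
      ≤⟨ +-monoˡ-≤ _ (minimal p′ (mergeAndIsolate-isKCut p v a b isKCut nontrivial)) ⟩
    cutSize G p′ + count (crossing? p a b) (edges G)
      ≤⟨ count-+-mono (separates? p′) (crossing? p a b) (separates? p) (incident? v)
                      (mergeAndIsolate-edge p v a b) (edges G) ⟩
    cutSize G p + degree G v
      ∎)
  where
  open ≤-Reasoning
  p′ : Fin n → Fin k
  p′ = mergeAndIsolate p v a b

lemma3p5 : ∀ (n k : ℕ) (G : Multigraph n) (δ : ℕ) (p : Fin n → Fin k) →
    2 ≤ k → IsMinDegree G δ → IsMinKCut G k p → Nontrivial p →
    cutSize G p ≤ k * k * δ
lemma3p5 n k G δ p _ (_ , v , degree-v≡δ) minimal nontrivial = begin
  cutSize G p
    ≤⟨ count-≤-fibres (separates? p) (p ∘ proj₁) (edges G) (λ a →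
       count-≤-fibres _ (p ∘ proj₂) (edges G) (λ b →
       crossing-count≤degree G minimal nontrivial v a b)) ⟩
  k * (k * degree G v) ≡⟨ cong (λ d → k * (k * d)) degree-v≡δ ⟩
  k * (k * δ)          ≡⟨ *-assoc k k δ ⟨
  k * k * δ            ∎
  where open ≤-Reasoning
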